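{- Let $T$ be a downward directed rooted tree with root $r$. Let $(S_T)$ be the pebbling assignment on $T$ with two or three pebbles on $r$, exactly one pebble on each non-root vertex of non-zero valence, and any number of pebbles on each vertex of valence zero. Then $T\cong [S_T]$ as directed graphs.
   Context: The valence of a vertex is its out-degree. A downward directed rooted tree is an oriented graph whose underlying undirected graph is a tree, with a vertex $r$ (the root) such that every edge is directed away from $r$ (every vertex is reached from $r$ by a directed path). A pebbling assignment assigns a nonnegative integer number of pebbles to each vertex. A pebbling move along an edge $(v,w)$ (allowed when $v$ has at least two pebbles) removes two pebbles from $v$ and adds one pebble to $w$. The assignment graph $[S_T]$ is the directed graph whose vertices are all assignments obtainable from $(S_T)$ by finite sequences of pebbling moves (including $(S_T)$ itself), with a directed edge from $A$ to $B$ whenever $B$ is obtained from $A$ by a single pebbling move. -}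

module Defs where

open import Data.Nat using (ℕ; zero; suc; _≤_; _∸_)
open import Data.Bool using (Bool; true; false; if_then_else_; T)
open import Data.Fin using (Fin)
open import Data.List using (List; []; _∷_; length; map; _∷ʳ_)
open import Data.Nat.ListAction using (sum)
open import Data.List.Relation.Unary.Linked using (Linked)
open import Data.List.Relation.Unary.Unique.Propositional using (Unique)
open import Data.Vec using (Vec; lookup; updateAt; allFin; toList)
open import Data.Product using (Σ; ∃; _×_; _,_)
open import Data.Sum using (_⊎_)
open import Relation.Nullary using (¬_)
open import Relation.Binary.PropositionalEquality using (_≡_; _≢_)
open import Relation.Binary.Construct.Closure.ReflexiveTransitive using (Star)

Graph : ℕ → Set
Graph n = Fin n → Fin n → Bool

module _ {n : ℕ} (G : Graph n) where

  Edge : Fin n → Fin n → Set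
  Edge u v = T (G u v)

  Oriented : Set
  Oriented = ∀ u v → Edge u v → ¬ Edge v u

  UEdge : Fin n → Fin n → Set
  UEdge u v = Edge u v ⊎ Edge v u

  -- a cycle x ∷ xs of the underlying undirected graph:
  -- at least 3 distinct vertices, consecutive ones adjacent, last adjacent to first
  UCycle : Fin n → List (Fin n) → Set
  UCycle x xs = (2 ≤ length xs) × Unique (x ∷ xs) × Linked UEdge (x ∷ xs ∷ʳ x)

  UnderlyingTree : Set
  UnderlyingTree = (∀ u v → Star UEdge u v) × (∀ x xs → ¬ UCycle x xs)

  DownwardRootedTree : Fin n → Set
  DownwardRootedTree r = Oriented × UnderlyingTree × (∀ v → Star Edge r v)

  -- valence = out-degree
  valence : Fin n → ℕ
  valence v = sum (map (λ w → if G v w then 1 else 0) (toList (allFin n)))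

  Assignment : Set
  Assignment = Vec ℕ n

  PebblingMove : Assignment → Assignment → Set
  PebblingMove A B = Σ (Fin n) λ v → Σ (Fin n) λ w →
    Edge v w × (2 ≤ lookup A v) × (B ≡ updateAt (updateAt A v (λ k → k ∸ 2)) w suc)

  -- B is a vertex of the assignment graph [S]
  Reachable : Assignment → Assignment → Set
  Reachable S B = Star PebblingMove S B

  IsST : Fin n → Assignment → Set
  IsST r S = ((lookup S r ≡ 2) ⊎ (lookup S r ≡ 3))
           × (∀ v → v ≢ r → valence v ≢ 0 → lookup S v ≡ 1)

  -- T ≅ [S] as directed graphs: a map f from vertices of T to assignments
  -- that is injective, whose image is exactly the vertex set of [S], and
  -- which preserves and reflects edges (edges of [S] are pebbling moves
  -- between vertices of [S]).
  IsoToAssignmentGraph : Assignment → Set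
  IsoToAssignmentGraph S = Σ (Fin n → Assignment) λ f →
      (∀ u v → f u ≡ f v → u ≡ v)
    × (∀ A → Reachable S A → ∃ λ u → f u ≡ A)
    × (∀ u → Reachable S (f u))
    × (∀ u v → (Edge u v → PebblingMove (f u) (f v)) × (PebblingMove (f u) (f v) → Edge u v))

{-# OPTIONS --safe #-}
-- In a graph whose underlying undirected graph is a forest, a non-backtracking walk never
-- repeats a vertex. Hence in the tree T the root has no incoming edge, every vertex has at
-- most one parent, and every vertex v has a unique path from r with a well-defined list of
-- strict ancestors. Send v to the assignment obtained from S by firing the moves along that
-- path: each strict ancestor is left with fewer than two pebbles (the root had 2 or 3 and gave
-- away 2, an inner vertex had 1, received 1 and gave away 2), v holds one extra pebble, and
-- every other vertex keeps its pebbles. So the only moves available are those from v along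
-- its out-edges, each leading to the assignment of the corresponding child; and distinct
-- vertices get distinct assignments, since a non-root vertex holds one pebble more in its own
-- assignment than in any other.
module Submission where

open import Defs
open import Data.Nat using (ℕ; suc; _≤_; _<_; _∸_; _+_; s≤s; z≤n)
open import Data.Nat.Properties using (m+n≡0⇒n≡0; <⇒≱; m∸n≤m; <-irrefl; m<n⇒m<1+n; ≤-refl; ≤-reflexive; 1+n≰n)
open import Data.Fin using (Fin)
open import Data.Fin.Properties using (_≟_)
open import Data.Bool using (Bool; true; false; if_then_else_; T)
open import Data.Unit using (⊤; tt)
open import Data.Empty using (⊥; ⊥-elim)
open import Data.List using (List; []; _∷_; length; map; _++_; _∷ʳ_; _ʳ++_; [_])
open import Data.Nat.ListAction using (sum)
open import Data.List.Relation.Unary.Any using (here; there)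
open import Data.List.Relation.Unary.All as All using ([]; _∷_)
open import Data.List.Relation.Unary.All.Properties using (¬Any⇒All¬; ++⁻ˡ; ++⁻ʳ)
open import Data.List.Relation.Unary.Linked using (Linked; [-]; _∷_)
open import Data.List.Relation.Unary.Unique.Propositional using (Unique; []; _∷_)
open import Data.List.Relation.Unary.Unique.Propositional.Properties using (Unique[x∷xs]⇒x∉xs)
open import Data.List.Relation.Binary.Disjoint.Propositional using (Disjoint)
open import Data.List.Membership.Propositional using (_∈_; _∉_)
open import Data.List.Membership.Propositional.Properties using (∈-∃++)
open import Data.Vec using (lookup; updateAt; allFin; toList; tabulate)
open import Data.Vec.Properties using (lookup∘updateAt; lookup∘updateAt′; lookup∘tabulate; tabulate∘lookup; tabulate-cong)
open import Data.Vec.Membership.Propositional.Properties using (∈-allFin⁺; ∈-toList⁺)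
open import Data.Product using (Σ; ∃; _×_; _,_; proj₁; proj₂)
open import Data.Sum using (_⊎_; inj₁; inj₂; swap)
open import Function using (_∘_; case_of_)
open import Relation.Nullary using (¬_; yes; no; does)
open import Relation.Nullary.Decidable using (dec-true; dec-false)
open import Relation.Binary.PropositionalEquality using (_≡_; _≢_; refl; sym; trans; cong; cong₂; subst; module ≡-Reasoning)
open import Relation.Binary.Construct.Closure.ReflexiveTransitive using (Star; ε; _◅_; gmap)

module _ {A : Set} where

  Unique-ʳ++⁻ʳ : ∀ xs {ys : List A} → Unique (xs ʳ++ ys) → Unique ys
  Unique-ʳ++⁻ʳ []       u = u
  Unique-ʳ++⁻ʳ (x ∷ xs) u with Unique-ʳ++⁻ʳ xs u
  ... | _ ∷ u′ = u′

  Unique-ʳ++⇒Disjoint : ∀ xs {ys : List A} → Unique (xs ʳ++ ys) → Disjoint xs ys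
  Unique-ʳ++⇒Disjoint (x ∷ xs) u (here refl , y∈ys) = Unique[x∷xs]⇒x∉xs (Unique-ʳ++⁻ʳ xs u) y∈ys
  Unique-ʳ++⇒Disjoint (x ∷ xs) u (there y∈xs , y∈ys) = Unique-ʳ++⇒Disjoint xs u (y∈xs , there y∈ys)

  Unique-++-∷⇒Unique-∷ : ∀ pre {y : A} {post} → Unique (pre ++ y ∷ post) → Unique (y ∷ pre)
  Unique-++-∷⇒Unique-∷ []        _           = [] ∷ []
  Unique-++-∷⇒Unique-∷ (a ∷ pre) (a∉ ∷ rest) with Unique-++-∷⇒Unique-∷ pre rest
  ... | y∉pre ∷ u = (y≢a ∷ y∉pre) ∷ ++⁻ˡ pre a∉ ∷ u
    where
    y≢a : _ ≢ a
    y≢a y≡a = All.head (++⁻ʳ pre a∉) (sym y≡a)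

module OrientedForest {n : ℕ} (G : Graph n) (oriented : Oriented G)
                      (acyclic : ∀ x xs → ¬ UCycle G x xs) where

  _≢head_ : Fin n → List (Fin n) → Set
  a ≢head []      = ⊤
  a ≢head (c ∷ _) = a ≢ c

  data NonBacktracking : List (Fin n) → Set where
    []   : NonBacktracking []
    [-]  : ∀ {x} → NonBacktracking [ x ]
    step : ∀ {a b t} → UEdge G a b → a ≢head t → NonBacktracking (b ∷ t) →
           NonBacktracking (a ∷ b ∷ t)

  NonBacktracking-tail : ∀ {x xs} → NonBacktracking (x ∷ xs) → NonBacktracking xs
  NonBacktracking-tail [-]          = []
  NonBacktracking-tail (step _ _ w) = w

  NonBacktracking⇒Linked-prefix : ∀ {a} pre {y} post →
    NonBacktracking (a ∷ pre ++ y ∷ post) → Linked (UEdge G) (a ∷ pre ∷ʳ y)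
  NonBacktracking⇒Linked-prefix []        post (step e _ _) = e ∷ [-]
  NonBacktracking⇒Linked-prefix (b ∷ pre) post (step e _ w) =
    e ∷ NonBacktracking⇒Linked-prefix pre post w

  no-loop : ∀ {x} → ¬ UEdge G x x
  no-loop (inj₁ e) = oriented _ _ e e
  no-loop (inj₂ e) = oriented _ _ e e

  -- The first return of the walk to y closes a cycle of the underlying graph.
  no-return : ∀ {y} pre post → NonBacktracking (y ∷ pre ++ y ∷ post) →
              Unique (pre ++ y ∷ post) → ⊥
  no-return []       post (step e _ _)   _ = no-loop e
  no-return (_ ∷ []) post (step _ y≢y _) _ = y≢y refl
  no-return {y} pre@(_ ∷ _ ∷ _) post w u =
    acyclic y pre (s≤s (s≤s z≤n) , Unique-++-∷⇒Unique-∷ pre u , NonBacktracking⇒Linked-prefix pre post w)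

  NonBacktracking⇒Unique : ∀ {xs} → NonBacktracking xs → Unique xs
  NonBacktracking⇒Unique {[]}     _ = []
  NonBacktracking⇒Unique {y ∷ zs} w = ¬Any⇒All¬ zs returns ∷ u
    where
    u : Unique zs
    u = NonBacktracking⇒Unique (NonBacktracking-tail w)
    returns : y ∈ zs → ⊥
    returns y∈zs with ∈-∃++ y∈zs
    ... | pre , post , refl = no-return pre post w u

  Diverge : List (Fin n) → List (Fin n) → Set
  Diverge []      _  = ⊤
  Diverge (a ∷ _) ys = a ≢head ys

  join-NonBacktracking : ∀ {x} xs {ys} → NonBacktracking (x ∷ xs) → NonBacktracking (x ∷ ys) →
                         Diverge xs ys → NonBacktracking ((x ∷ xs) ʳ++ ys)
  join-NonBacktracking []       _             v _  = v
  join-NonBacktracking (y ∷ xs) (step e x≢ w) v y≢ =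
    join-NonBacktracking xs w (step (swap e) y≢ v) (diverge xs x≢)
    where
    diverge : ∀ {x ys} xs → x ≢head xs → Diverge xs (x ∷ ys)
    diverge []      _   = tt
    diverge (_ ∷ _) x≢z = λ z≡x → x≢z (sym z≡x)

  diverging-walks-disjoint : ∀ {x} xs {ys} → NonBacktracking (x ∷ xs) → NonBacktracking (x ∷ ys) →
                             Diverge xs ys → Disjoint (x ∷ xs) ys
  diverging-walks-disjoint xs w v d =
    Unique-ʳ++⇒Disjoint (_ ∷ xs) (NonBacktracking⇒Unique (join-NonBacktracking xs w v d))

sum-indicator≢0 : ∀ {A : Set} (g : A → Bool) {w} xs → w ∈ xs → T (g w) →
                  sum (map (λ x → if g x then 1 else 0) xs) ≢ 0
sum-indicator≢0 g (x ∷ xs) (here refl) gw with g x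
... | true  = λ ()
... | false = ⊥-elim gw
sum-indicator≢0 g (x ∷ xs) (there w∈) gw = sum-indicator≢0 g xs w∈ gw ∘ m+n≡0⇒n≡0 _

edge⇒valence≢0 : ∀ {n} (G : Graph n) {v w} → Edge G v w → valence G v ≢ 0
edge⇒valence≢0 {n} G {w = w} = sum-indicator≢0 (G _) (toList (allFin n)) (∈-toList⁺ (∈-allFin⁺ w))

module RootedTree {n : ℕ} (G : Graph n) (r : Fin n) (tree : DownwardRootedTree G r) where

  oriented : Oriented G
  oriented = proj₁ tree

  open OrientedForest G oriented (proj₂ (proj₁ (proj₂ tree)))

  data Path : Fin n → Set where
    root : Path r
    snoc : ∀ {u w} → Path u → Edge G u w → Path w

  ancestorsOn : ∀ {v} → Path v → List (Fin n)
  ancestorsOn root             = []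
  ancestorsOn (snoc {u} p _) = u ∷ ancestorsOn p

  Star⇒Path : ∀ {u v} → Path u → Star (Edge G) u v → Path v
  Star⇒Path p ε       = p
  Star⇒Path p (e ◅ s) = Star⇒Path (snoc p e) s

  pathTo : ∀ v → Path v
  pathTo v = Star⇒Path root (proj₂ (proj₂ tree) v)

  ancestors : Fin n → List (Fin n)
  ancestors v = ancestorsOn (pathTo v)

  grandparent-≢-child : ∀ {u w} (p : Path u) → Edge G u w → w ≢head ancestorsOn p
  grandparent-≢-child root        _ = tt
  grandparent-≢-child (snoc p e′) e refl = oriented _ _ e e′

  ancestors-diverge-from-child : ∀ {u w ys} (p : Path u) → Edge G u w → Diverge (ancestorsOn p) (w ∷ ys)
  ancestors-diverge-from-child root        _ = tt
  ancestors-diverge-from-child (snoc p e′) e refl = oriented _ _ e e′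

  Path⇒NonBacktracking : ∀ {v} (p : Path v) → NonBacktracking (v ∷ ancestorsOn p)
  Path⇒NonBacktracking root       = [-]
  Path⇒NonBacktracking (snoc p e) = step (inj₂ e) (grandparent-≢-child p e) (Path⇒NonBacktracking p)

  root∈Path : ∀ {v} (p : Path v) → r ∈ v ∷ ancestorsOn p
  root∈Path root       = here refl
  root∈Path (snoc p _) = there (root∈Path p)

  child-≢-parent : ∀ {v w} → Edge G v w → w ≢ v
  child-≢-parent e refl = oriented _ _ e e

  no-edge-into-root : ∀ {u} → ¬ Edge G u r
  no-edge-into-root {u} e =
    diverging-walks-disjoint (ancestorsOn p) (Path⇒NonBacktracking p) (step (inj₁ e) tt [-])
      (ancestors-diverge-from-child p e) (root∈Path p , here refl)
    where
    p : Path u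
    p = pathTo u

  child-≢-root : ∀ {v w} → Edge G v w → w ≢ r
  child-≢-root e refl = no-edge-into-root e

  parent-unique : ∀ {a b w} → Edge G a w → Edge G b w → a ≡ b
  parent-unique {a} {b} ea eb with a ≟ b
  ... | yes a≡b = a≡b
  ... | no  a≢b = ⊥-elim (diverging-walks-disjoint (ancestorsOn (snoc (pathTo a) ea))
          (Path⇒NonBacktracking (snoc (pathTo a) ea)) (Path⇒NonBacktracking (snoc (pathTo b) eb))
          a≢b (there (root∈Path (pathTo a)) , root∈Path (pathTo b)))

  ancestorsOn-unique : ∀ {v} (p q : Path v) → ancestorsOn p ≡ ancestorsOn q
  ancestorsOn-unique root       root        = refl
  ancestorsOn-unique root       (snoc _ e)  = ⊥-elim (no-edge-into-root e)
  ancestorsOn-unique (snoc _ e) root        = ⊥-elim (no-edge-into-root e)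
  ancestorsOn-unique (snoc p e) (snoc q e′) with parent-unique e e′
  ... | refl = cong (_ ∷_) (ancestorsOn-unique p q)

  ancestors-root : ancestors r ≡ []
  ancestors-root = ancestorsOn-unique (pathTo r) root

  ancestors-child : ∀ {v w} → Edge G v w → ancestors w ≡ v ∷ ancestors v
  ancestors-child e = ancestorsOn-unique (pathTo _) (snoc (pathTo _) e)

  root∈ancestors : ∀ {v} → v ≢ r → r ∈ ancestors v
  root∈ancestors {v} v≢r with root∈Path (pathTo v)
  ... | here r≡v = ⊥-elim (v≢r (sym r≡v))
  ... | there r∈ = r∈

  parent∈ancestors : ∀ {v w} → Edge G v w → v ∈ ancestors w
  parent∈ancestors e = subst (_ ∈_) (sym (ancestors-child e)) (here refl)

  ancestor-of-parent : ∀ {v w x} → Edge G v w → x ∈ ancestors v → x ∈ ancestors w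
  ancestor-of-parent e x∈ = subst (_ ∈_) (sym (ancestors-child e)) (there x∈)

  ∉-ancestors-child : ∀ {v w x} → Edge G v w → x ≢ v → x ∉ ancestors v → x ∉ ancestors w
  ∉-ancestors-child e x≢v x∉ x∈ with subst (_ ∈_) (ancestors-child e) x∈
  ... | here x≡v  = x≢v x≡v
  ... | there x∈′ = x∉ x∈′

  shorter-path-to-ancestor : ∀ {v x} (p : Path v) → x ∈ ancestorsOn p →
                             Σ (Path x) λ q → length (ancestorsOn q) < length (ancestorsOn p)
  shorter-path-to-ancestor (snoc p _) (here refl) = p , ≤-refl
  shorter-path-to-ancestor (snoc p _) (there x∈) with shorter-path-to-ancestor p x∈
  ... | q , q<p = q , m<n⇒m<1+n q<p

  ∉-ancestors : ∀ v → v ∉ ancestors v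
  ∉-ancestors v v∈ with shorter-path-to-ancestor (pathTo v) v∈
  ... | q , q<p = <-irrefl (cong length (ancestorsOn-unique q (pathTo v))) q<p

module PebblingAlongPaths {n : ℕ} (G : Graph n) (r : Fin n) (tree : DownwardRootedTree G r)
                          (S : Assignment G) (S-is-ST : IsST G r S) where

  open RootedTree G r tree
  open import Data.List.Membership.DecPropositional (_≟_ {n}) using (_∈?_)
  open ≡-Reasoning

  -- The pebbles a vertex receives when the moves along the path from r reach it.
  inflow : Fin n → ℕ
  inflow x = if does (x ≟ r) then 0 else 1

  inflow-root : inflow r ≡ 0
  inflow-root rewrite dec-true (r ≟ r) refl = refl

  inflow-nonroot : ∀ {x} → x ≢ r → inflow x ≡ 1
  inflow-nonroot {x} x≢r rewrite dec-false (x ≟ r) x≢r = refl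

  -- The assignment reached from S by the moves along the path from r to v:
  -- every strict ancestor received its inflow and passed two pebbles on.
  pebbles : Fin n → Fin n → ℕ
  pebbles v x =
    if does (x ∈? ancestors v) then inflow x + lookup S x ∸ 2
    else if does (x ≟ v) then inflow x + lookup S x
    else lookup S x

  pebblingAt : Fin n → Assignment G
  pebblingAt v = tabulate (pebbles v)

  pebbles-ancestor : ∀ {v x} → x ∈ ancestors v → pebbles v x ≡ inflow x + lookup S x ∸ 2
  pebbles-ancestor {v} {x} x∈ rewrite dec-true (x ∈? ancestors v) x∈ = refl

  pebbles-tip : ∀ v → pebbles v v ≡ inflow v + lookup S v
  pebbles-tip v rewrite dec-false (v ∈? ancestors v) (∉-ancestors v) | dec-true (v ≟ v) refl = refl

  pebbles-off-path : ∀ {v x} → x ∉ ancestors v → x ≢ v → pebbles v x ≡ lookup S x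
  pebbles-off-path {v} {x} x∉ x≢v rewrite dec-false (x ∈? ancestors v) x∉ | dec-false (x ≟ v) x≢v = refl

  pebblingAt-root : pebblingAt r ≡ S
  pebblingAt-root = trans (tabulate-cong pebbles-root) (tabulate∘lookup S)
    where
    pebbles-root : ∀ x → pebbles r x ≡ lookup S x
    pebbles-root x = case x ≟ r of λ where
      (yes refl) → trans (pebbles-tip r) (cong (_+ lookup S r) inflow-root)
      (no  x≢r)  → pebbles-off-path (subst (x ∉_) (sym ancestors-root) λ ()) x≢r

  lookup-pebblingAt : ∀ v x → lookup (pebblingAt v) x ≡ pebbles v x
  lookup-pebblingAt v = lookup∘tabulate (pebbles v)

  drain : Assignment G → Fin n → Assignment G
  drain A v = updateAt A v (λ k → k ∸ 2)

  fire : Assignment G → Fin n → Fin n → Assignment G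
  fire A v w = updateAt (drain A v) w suc

  fire-pebblingAt-target : ∀ {v w} → Edge G v w → lookup (fire (pebblingAt v) v w) w ≡ pebbles w w
  fire-pebblingAt-target {v} {w} e = begin
    lookup (fire (pebblingAt v) v w) w ≡⟨ lookup∘updateAt w (drain (pebblingAt v) v) ⟩
    suc (lookup (drain (pebblingAt v) v) w)
                                       ≡⟨ cong suc (lookup∘updateAt′ w v w≢v (pebblingAt v)) ⟩
    suc (lookup (pebblingAt v) w)      ≡⟨ cong suc (lookup-pebblingAt v w) ⟩
    suc (pebbles v w)                  ≡⟨ cong suc (pebbles-off-path w∉ w≢v) ⟩
    1 + lookup S w                     ≡⟨ cong (_+ lookup S w) (sym (inflow-nonroot (child-≢-root e))) ⟩
    inflow w + lookup S w              ≡⟨ sym (pebbles-tip w) ⟩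
    pebbles w w                        ∎
    where
    w≢v : w ≢ v
    w≢v = child-≢-parent e
    w∉ : w ∉ ancestors v
    w∉ = ∉-ancestors w ∘ ancestor-of-parent e

  fire-pebblingAt-source : ∀ {v w} → Edge G v w → v ≢ w → lookup (fire (pebblingAt v) v w) v ≡ pebbles w v
  fire-pebblingAt-source {v} {w} e v≢w = begin
    lookup (fire (pebblingAt v) v w) v ≡⟨ lookup∘updateAt′ v w v≢w (drain (pebblingAt v) v) ⟩
    lookup (drain (pebblingAt v) v) v  ≡⟨ lookup∘updateAt v (pebblingAt v) ⟩
    lookup (pebblingAt v) v ∸ 2        ≡⟨ cong (_∸ 2) (lookup-pebblingAt v v) ⟩
    pebbles v v ∸ 2                    ≡⟨ cong (_∸ 2) (pebbles-tip v) ⟩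
    inflow v + lookup S v ∸ 2          ≡⟨ sym (pebbles-ancestor (parent∈ancestors e)) ⟩
    pebbles w v                        ∎

  pebbles-child-elsewhere : ∀ {v w x} → Edge G v w → x ≢ w → x ≢ v → pebbles v x ≡ pebbles w x
  pebbles-child-elsewhere {v} {w} {x} e x≢w x≢v = case x ∈? ancestors v of λ where
    (yes x∈) → trans (pebbles-ancestor x∈) (sym (pebbles-ancestor (ancestor-of-parent e x∈)))
    (no x∉)  → trans (pebbles-off-path x∉ x≢v) (sym (pebbles-off-path (∉-ancestors-child e x≢v x∉) x≢w))

  fire-pebblingAt-elsewhere : ∀ {v w x} → Edge G v w → x ≢ w → x ≢ v →
                              lookup (fire (pebblingAt v) v w) x ≡ pebbles w x
  fire-pebblingAt-elsewhere {v} {w} {x} e x≢w x≢v = begin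
    lookup (fire (pebblingAt v) v w) x ≡⟨ lookup∘updateAt′ x w x≢w (drain (pebblingAt v) v) ⟩
    lookup (drain (pebblingAt v) v) x  ≡⟨ lookup∘updateAt′ x v x≢v (pebblingAt v) ⟩
    lookup (pebblingAt v) x            ≡⟨ lookup-pebblingAt v x ⟩
    pebbles v x                        ≡⟨ pebbles-child-elsewhere e x≢w x≢v ⟩
    pebbles w x                        ∎

  fire-pebblingAt : ∀ {v w} → Edge G v w → fire (pebblingAt v) v w ≡ pebblingAt w
  fire-pebblingAt {v} {w} e = trans (sym (tabulate∘lookup _)) (tabulate-cong after-move)
    where
    after-move : ∀ x → lookup (fire (pebblingAt v) v w) x ≡ pebbles w x
    after-move x = case x ≟ w of λ where
      (yes refl) → fire-pebblingAt-target e
      (no x≢w)   → case x ≟ v of λ where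
        (yes refl) → fire-pebblingAt-source e x≢w
        (no x≢v)   → fire-pebblingAt-elsewhere e x≢w x≢v

  root-pebbles : lookup S r ≡ 2 ⊎ lookup S r ≡ 3
  root-pebbles = proj₁ S-is-ST

  nonleaf-has-one : ∀ {u w} → u ≢ r → Edge G u w → lookup S u ≡ 1
  nonleaf-has-one u≢r e = proj₂ S-is-ST _ u≢r (edge⇒valence≢0 G e)

  root-can-move : 2 ≤ lookup S r
  root-can-move with root-pebbles
  ... | inj₁ two   rewrite two   = ≤-refl
  ... | inj₂ three rewrite three = s≤s (s≤s z≤n)

  tip-can-move : ∀ {v w} → Edge G v w → 2 ≤ pebbles v v
  tip-can-move {v} e rewrite pebbles-tip v = case v ≟ r of λ where
    (yes refl) → subst (2 ≤_) (sym (cong (_+ lookup S r) inflow-root)) root-can-move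
    (no v≢r)   → subst (2 ≤_) (sym (cong₂ _+_ (inflow-nonroot v≢r) (nonleaf-has-one v≢r e))) ≤-refl

  root-drained : lookup S r ∸ 2 < 2
  root-drained with root-pebbles
  ... | inj₁ two   rewrite two   = s≤s z≤n
  ... | inj₂ three rewrite three = s≤s (s≤s z≤n)

  drained-below-two : ∀ {u w} → Edge G u w → inflow u + lookup S u ∸ 2 < 2
  drained-below-two {u} e = case u ≟ r of λ where
    (yes refl) → subst (λ k → k + lookup S r ∸ 2 < 2) (sym inflow-root) root-drained
    (no u≢r)   → subst (λ k → k ∸ 2 < 2) (sym (cong₂ _+_ (inflow-nonroot u≢r) (nonleaf-has-one u≢r e))) (s≤s z≤n)

  off-path⇒nonroot : ∀ {u v} → u ∉ ancestors v → u ≢ v → u ≢ r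
  off-path⇒nonroot u∉ u≢v refl = u∉ (root∈ancestors (λ v≡r → u≢v (sym v≡r)))

  off-tip-cannot-move : ∀ {u v w} → u ≢ v → Edge G u w → pebbles v u < 2
  off-tip-cannot-move {u} {v} u≢v e = case u ∈? ancestors v of λ where
    (yes u∈) → subst (_< 2) (sym (pebbles-ancestor u∈)) (drained-below-two e)
    (no u∉)  → let u≢r = off-path⇒nonroot u∉ u≢v in
               subst (_< 2) (sym (trans (pebbles-off-path u∉ u≢v) (nonleaf-has-one u≢r e))) ≤-refl

  pebbling-move : ∀ {v w} → Edge G v w → PebblingMove G (pebblingAt v) (pebblingAt w)
  pebbling-move {v} e =
    _ , _ , e , subst (2 ≤_) (sym (lookup-pebblingAt v v)) (tip-can-move e) , sym (fire-pebblingAt e)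

  moves-from-pebblingAt : ∀ {v B} → PebblingMove G (pebblingAt v) B → ∃ λ w → Edge G v w × B ≡ pebblingAt w
  moves-from-pebblingAt {v} (u , w , e , can-move , refl) with u ≟ v
  ... | yes refl = w , e , fire-pebblingAt e
  ... | no  u≢v  = ⊥-elim (<⇒≱ (off-tip-cannot-move u≢v e) (subst (2 ≤_) (lookup-pebblingAt v u) can-move))

  pebbles-≤ : ∀ {v x} → x ≢ v → x ≢ r → pebbles v x ≤ lookup S x
  pebbles-≤ {v} {x} x≢v x≢r = case x ∈? ancestors v of λ where
    (yes x∈) → subst (_≤ lookup S x)
                     (sym (trans (pebbles-ancestor x∈) (cong (λ k → k + lookup S x ∸ 2) (inflow-nonroot x≢r))))
                     (m∸n≤m (lookup S x) 1)
    (no x∉)  → ≤-reflexive (pebbles-off-path x∉ x≢v)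

  pebblingAt-separates : ∀ {u v} → u ≢ v → u ≢ r → pebblingAt u ≢ pebblingAt v
  pebblingAt-separates {u} {v} u≢v u≢r eq = 1+n≰n (subst (_≤ lookup S u) tip-of-u (pebbles-≤ u≢v u≢r))
    where
    tip-of-u : pebbles v u ≡ suc (lookup S u)
    tip-of-u = begin
      pebbles v u              ≡⟨ sym (lookup-pebblingAt v u) ⟩
      lookup (pebblingAt v) u  ≡⟨ cong (λ A → lookup A u) (sym eq) ⟩
      lookup (pebblingAt u) u  ≡⟨ lookup-pebblingAt u u ⟩
      pebbles u u              ≡⟨ pebbles-tip u ⟩
      inflow u + lookup S u    ≡⟨ cong (_+ lookup S u) (inflow-nonroot u≢r) ⟩
      suc (lookup S u)         ∎

  pebblingAt-injective : ∀ u v → pebblingAt u ≡ pebblingAt v → u ≡ v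
  pebblingAt-injective u v eq with u ≟ v | u ≟ r
  ... | yes u≡v | _       = u≡v
  ... | no  u≢v | no  u≢r = ⊥-elim (pebblingAt-separates u≢v u≢r eq)
  ... | no  u≢v | yes u≡r = ⊥-elim (pebblingAt-separates (u≢v ∘ sym) (λ v≡r → u≢v (trans u≡r (sym v≡r))) (sym eq))

  pebblingAt-reachable : ∀ v → Reachable G S (pebblingAt v)
  pebblingAt-reachable v =
    subst (λ A → Reachable G A (pebblingAt v)) pebblingAt-root (gmap pebblingAt pebbling-move (proj₂ (proj₂ tree) v))

  reachable⇒pebblingAt : ∀ {v A} → Reachable G (pebblingAt v) A → ∃ λ u → pebblingAt u ≡ A
  reachable⇒pebblingAt {v} ε = v , refl
  reachable⇒pebblingAt (m ◅ ms) with moves-from-pebblingAt m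
  ... | w , _ , refl = reachable⇒pebblingAt ms

  move⇒edge : ∀ {u v} → PebblingMove G (pebblingAt u) (pebblingAt v) → Edge G u v
  move⇒edge {u} {v} m with moves-from-pebblingAt m
  ... | w , e , eq = subst (Edge G u) (sym (pebblingAt-injective v w eq)) e

theorem5p1 : (n : ℕ) (G : Graph n) (r : Fin n) → DownwardRootedTree G r →
    (S : Assignment G) → IsST G r S → IsoToAssignmentGraph G S
theorem5p1 n G r tree S S-is-ST =
    pebblingAt
  , pebblingAt-injective
  , (λ A S↝A → reachable⇒pebblingAt (subst (λ B → Reachable G B A) (sym pebblingAt-root) S↝A))
  , pebblingAt-reachable
  , (λ u v → pebbling-move , move⇒edge)
  where open PebblingAlongPaths G r tree S S-is-ST
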